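{- Let $n,s,h\in\mathbb{Z}^+$ with $1\le s\le n-2$ and $h\le n-1$. Then there is an $s$-overlap cycle for the set of strings of length $n$ with ground set $[h]$, i.e. the set of strings $x_1x_2\ldots x_n$ with each $x_i\in[h]$ and every element of $[h]$ appearing at least once (equivalently, surjective functions $f:[n]\to[h]$ represented by $x_i=f(i)$).
   Context: $[h]=\{1,\ldots,h\}$. For a set $\mathcal{C}$ of strings of length $n$ and $1\le s\le n-1$, an $s$-overlap cycle on $\mathcal{C}$ is a cyclic ordering of $\mathcal{C}$ in which every element appears exactly once and, whenever $b=b_1\ldots b_n$ immediately follows $a=a_1\ldots a_n$ (cyclically, so the first element also follows the last), the last $s$ letters of $a$ equal the first $s$ letters of $b$. -}

module Defs where

open import Data.Nat using (ℕ; zero; suc; _+_; _∸_; _<_; _≤_)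
open import Data.Fin using (Fin; toℕ)
open import Data.Vec using (Vec; lookup)
open import Data.List using (List; []; _∷_)
open import Data.List.Relation.Unary.Unique.Propositional using (Unique)
open import Data.List.Membership.Propositional using (_∈_)
open import Data.Product using (Σ; ∃; _×_; _,_)
open import Data.Unit using (⊤)
open import Relation.Binary.PropositionalEquality using (_≡_)
open import Function.Bundles using (_⇔_)

-- A string of length n over the alphabet [h] = Fin h (letter k ∈ Fin h stands for k+1).
Word : ℕ → ℕ → Set
Word h n = Vec (Fin h) n

Surjective : ∀ {h n} → Word h n → Set
Surjective {h} {n} w = ∀ (k : Fin h) → Σ (Fin n) λ i → lookup w i ≡ k

-- The last s letters of a equal the first s letters of b
-- (positions are 0-based: a_{n-s+j} = b_j for 0 ≤ j < s).
Overlap : ∀ {h n} → ℕ → Word h n → Word h n → Set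
Overlap {h} {n} s a b =
  ∀ (j : Fin n) (k : Fin n) → toℕ j < s → toℕ k ≡ (n ∸ s) + toℕ j → lookup a k ≡ lookup b j

ChainOverlap : ∀ {h n} → ℕ → List (Word h n) → Set
ChainOverlap s [] = ⊤
ChainOverlap s (a ∷ []) = ⊤
ChainOverlap s (a ∷ b ∷ rest) = Overlap s a b × ChainOverlap s (b ∷ rest)

lastOverlapsFirst : ∀ {h n} → ℕ → Word h n → List (Word h n) → Set
lastOverlapsFirst s first [] = Overlap s first first
lastOverlapsFirst s first (a ∷ []) = Overlap s a first
lastOverlapsFirst s first (a ∷ b ∷ rest) = lastOverlapsFirst s first (b ∷ rest)

CyclicOverlap : ∀ {h n} → ℕ → List (Word h n) → Set
CyclicOverlap s [] = ⊤
CyclicOverlap s (a ∷ rest) = ChainOverlap s (a ∷ rest) × lastOverlapsFirst s a rest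

IsOverlapCycle : ∀ {h n} → ℕ → (Word h n → Set) → List (Word h n) → Set
IsOverlapCycle {h} {n} s C L =
  Unique L × (∀ (w : Word h n) → (w ∈ L) ⇔ C w) × CyclicOverlap s L

-- Let m = n − s and let rotate move the last s letters of a word to its front (a cyclic shift by m),
-- so that every word s-overlaps its rotation and each rotation orbit is an s-overlap cycle. Start from
-- one orbit and, as long as some missing surjective word y has the same first s letters as a word x of
-- the cycle, splice the orbit of y in just before x. When this stops, the cycle is closed under
-- rotation and under changing letters outside the first s positions. A letter change at a position
-- p < s becomes one at position p − m after a rotation, so the cycle is closed under every single-letter
-- change between surjective words. Since h < n, some letter of a surjective word always occurs twice,
-- which lets one walk by such changes from any surjective word to a fixed one; hence the cycle contains
-- every surjective word.
module Submission where

open import Defs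
open import Data.Nat
  using (ℕ; zero; suc; _+_; _*_; _∸_; _≤_; _<_; z≤n; s≤s; s≤s⁻¹; z<s; pred; NonZero; >-nonZero; _<?_; _≤?_; _%_)
open import Data.Nat.Properties
open import Data.Nat.GeneralisedArithmetic using (fold; fold-+)
open import Data.Nat.DivMod using (_mod_; m%n<n; m<n⇒m%n≡m; %-distribˡ-+; m%n%n≡m%n; [m+kn]%n≡m%n)
open import Data.Fin using (Fin; toℕ; fromℕ<)
open import Data.Fin.Properties using (toℕ-injective; toℕ<n; toℕ-fromℕ<; pigeonhole; any?; all?)
  renaming (_≟_ to _≟ᶠ_)
open import Data.Vec using (Vec; []; _∷_; lookup; tabulate; _[_]≔_)
open import Data.Vec.Properties using (≡-dec; lookup∘tabulate; lookup∘update; lookup∘update′)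
open import Data.Vec.Relation.Binary.Pointwise.Extensional using (ext; Pointwise-≡⇒≡)
open import Data.List using (List; []; _∷_; _++_; applyUpTo; cartesianProductWith; allFin)
open import Data.List.Relation.Unary.Any using (Any; here; there)
import Data.List.Relation.Unary.Any as Any
open import Data.List.Membership.Propositional using (_∈_; _∉_; find; lose)
open import Data.List.Membership.Propositional.Properties
  using (∈-∃++; ∈-applyUpTo⁺; ∈-applyUpTo⁻; ∈-cartesianProductWith⁺; ∈-allFin; ∈-++⁺ˡ; ∈-++⁺ʳ; ∈-++⁻)
open import Data.List.Relation.Unary.Unique.Propositional using (Unique)
open import Data.List.Relation.Unary.Unique.Propositional.Properties using (applyUpTo⁺₁; ++⁺)
open import Data.List.Relation.Binary.Disjoint.Propositional using (Disjoint)
open import Data.List.Relation.Binary.Subset.Propositional using (_⊆_)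
import Data.List.Relation.Binary.Permutation.Setoid as Permutation
import Data.List.Relation.Binary.Permutation.Setoid.Properties as PermutationProperties
open import Data.Product using (Σ; ∃-syntax; _×_; _,_; proj₁; proj₂)
open import Data.Sum using (_⊎_; inj₁; inj₂; [_,_])
open import Data.Unit using (tt)
open import Function using (_∘_)
open import Function.Bundles using (mk⇔)
open import Relation.Nullary using (Dec; yes; no; ¬_; ¬?; contradiction)
open import Relation.Nullary.Decidable using (_×-dec_; _→-dec_)
open import Relation.Unary using (Decidable)
open import Relation.Binary.Definitions using (DecidableEquality)
open import Relation.Binary.PropositionalEquality
  using (_≡_; _≢_; refl; sym; trans; cong; subst; module ≡-Reasoning)
open import Relation.Binary.PropositionalEquality.Properties using (setoid)

module _ {A : Set} where

  open Permutation (setoid A) using (_↭_; ↭-refl)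
  open PermutationProperties (setoid A) using () renaming (++-comm to ↭-++-comm)

  Walk : (A → A → Set) → A → List A → A → Set
  Walk R p []       q = R p q
  Walk R p (x ∷ xs) q = R p x × Walk R x xs q

  module _ {R : A → A → Set} where

    Walk-++ : ∀ {p y q} xs {ys} → Walk R p xs y → Walk R y ys q → Walk R p (xs ++ y ∷ ys) q
    Walk-++ []       pRy         y⇝q = pRy , y⇝q
    Walk-++ (x ∷ xs) (pRx , x⇝y) y⇝q = pRx , Walk-++ xs x⇝y y⇝q

    Walk-++⁻ : ∀ {p y q} xs {ys} → Walk R p (xs ++ y ∷ ys) q → Walk R p xs y × Walk R y ys q
    Walk-++⁻ []       w           = w
    Walk-++⁻ (x ∷ xs) (pRx , x⇝q) = let x⇝y , y⇝q = Walk-++⁻ xs x⇝q in (pRx , x⇝y) , y⇝q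

    Walk-mapLast : ∀ {p q q′} xs → (∀ r → R r q → R r q′) → Walk R p xs q → Walk R p xs q′
    Walk-mapLast []       f pRq         = f _ pRq
    Walk-mapLast (x ∷ xs) f (pRx , x⇝q) = pRx , Walk-mapLast xs f x⇝q

    Walk-applyUpTo : ∀ (f : ℕ → A) → (∀ i → R (f i) (f (suc i))) →
                     ∀ k → Walk R (f 0) (applyUpTo (λ i → f (suc i)) k) (f (suc k))
    Walk-applyUpTo f step zero    = step 0
    Walk-applyUpTo f step (suc k) = step 0 , Walk-applyUpTo (λ i → f (suc i)) (λ i → step (suc i)) k

    Walk-rotate : ∀ {a x} rest → Walk R a rest a → x ∈ a ∷ rest →
                  ∃[ rest′ ] Walk R x rest′ x × (a ∷ rest) ↭ (x ∷ rest′)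
    Walk-rotate {a} {x} rest a⇝a x∈ with ∈-∃++ x∈
    ... | []       , rest′ , refl = rest′ , a⇝a , ↭-refl
    ... | (_ ∷ ys) , zs    , refl =
      let a⇝x , x⇝a = Walk-++⁻ ys a⇝a
      in zs ++ a ∷ ys , Walk-++ zs x⇝a a⇝x , ↭-++-comm (a ∷ ys) (x ∷ zs)

module _ {h n s : ℕ} where

  private
    Walk⇒chain : ∀ {first : Word h n} p xs → Walk (Overlap s) p xs first →
                 ChainOverlap s (p ∷ xs) × lastOverlapsFirst s first (p ∷ xs)
    Walk⇒chain p []       p⇝first          = tt , p⇝first
    Walk⇒chain p (x ∷ xs) (pRx , x⇝first) = let chain , last = Walk⇒chain x xs x⇝first in (pRx , chain) , last

  Walk⇒CyclicOverlap : ∀ {a : Word h n} rest → Walk (Overlap s) a rest a → CyclicOverlap s (a ∷ rest)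
  Walk⇒CyclicOverlap []      a⇝a         = tt , a⇝a
  Walk⇒CyclicOverlap (b ∷ r) (aRb , b⇝a) = let chain , last = Walk⇒chain b r b⇝a in (aRb , chain) , last

leastWitness : ∀ {P : ℕ → Set} → Decidable P → ∀ {b} → P b → ∃[ k ] P k × (∀ j → j < k → ¬ P j)
leastWitness {P} P? {zero} p = 0 , p , λ _ ()
leastWitness {P} P? {suc b} p with P? 0
... | yes p₀ = 0 , p₀ , λ _ ()
... | no ¬p₀ with leastWitness {λ j → P (suc j)} (λ j → P? (suc j)) {b} p
...   | k , pk , below = suc k , pk , λ { zero _ → ¬p₀ ; (suc j) (s≤s j<k) → below j j<k }

module Missing {A : Set} (_≟_ : DecidableEquality A) where

  open import Data.List.Membership.DecPropositional _≟_ using (_∈?_)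

  missing : List A → List A → ℕ
  missing L []       = 0
  missing L (w ∷ ws) with w ∈? L
  ... | yes _ = missing L ws
  ... | no  _ = suc (missing L ws)

  missing-mono : ∀ {L L′} → L ⊆ L′ → ∀ ws → missing L′ ws ≤ missing L ws
  missing-mono L⊆L′ []       = z≤n
  missing-mono {L} {L′} L⊆L′ (w ∷ ws) with w ∈? L | w ∈? L′
  ... | yes _   | yes _    = missing-mono L⊆L′ ws
  ... | yes w∈L | no w∉L′  = contradiction (L⊆L′ w∈L) w∉L′
  ... | no _    | yes _    = m≤n⇒m≤1+n (missing-mono L⊆L′ ws)
  ... | no _    | no _     = s≤s (missing-mono L⊆L′ ws)

  missing-strict : ∀ {L L′ y} → L ⊆ L′ → y ∉ L → y ∈ L′ →
                   ∀ {ws} → y ∈ ws → missing L′ ws < missing L ws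
  missing-strict {L} {L′} L⊆L′ y∉L y∈L′ {w ∷ ws} (here refl) with w ∈? L | w ∈? L′
  ... | yes y∈L | _       = contradiction y∈L y∉L
  ... | no _    | no y∉L′ = contradiction y∈L′ y∉L′
  ... | no _    | yes _   = s≤s (missing-mono L⊆L′ ws)
  missing-strict {L} {L′} L⊆L′ y∉L y∈L′ {w ∷ ws} (there y∈ws) with w ∈? L | w ∈? L′
  ... | yes _   | yes _    = missing-strict L⊆L′ y∉L y∈L′ y∈ws
  ... | yes w∈L | no w∉L′  = contradiction (L⊆L′ w∈L) w∉L′
  ... | no _    | yes _    = m<n⇒m<1+n (missing-strict L⊆L′ y∉L y∈L′ y∈ws)
  ... | no _    | no _     = s≤s (missing-strict L⊆L′ y∉L y∈L′ y∈ws)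

module _ {A : Set} where

  vecs : List A → ∀ k → List (Vec A k)
  vecs xs zero    = [] ∷ []
  vecs xs (suc k) = cartesianProductWith _∷_ xs (vecs xs k)

  ∈-vecs : ∀ {xs} → (∀ x → x ∈ xs) → ∀ {k} (v : Vec A k) → v ∈ vecs xs k
  ∈-vecs all []       = here refl
  ∈-vecs all (x ∷ v) = ∈-cartesianProductWith⁺ _∷_ (all x) (∈-vecs all v)

module _ {h n : ℕ} where

  AgreeBelow : ℕ → Word h n → Word h n → Set
  AgreeBelow i u v = ∀ r → toℕ r < i → lookup u r ≡ lookup v r

  AgreeBelow-sym : ∀ {i u v} → AgreeBelow i u v → AgreeBelow i v u
  AgreeBelow-sym agree r r<i = sym (agree r r<i)

  AgreeExcept : Fin n → Word h n → Word h n → Set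
  AgreeExcept p u v = ∀ r → r ≢ p → lookup u r ≡ lookup v r

  Repeated : Word h n → Fin n → Set
  Repeated u p = ∃[ p′ ] p′ ≢ p × lookup u p′ ≡ lookup u p

  EditClosed : (Word h n → Set) → Set
  EditClosed P = ∀ {u v} p → Surjective u → Surjective v → AgreeExcept p u v → P u → P v

  surjective? : ∀ u → Dec (Surjective {h} {n} u)
  surjective? u = all? λ k → any? λ i → lookup u i ≟ᶠ k

  agreeBelow? : ∀ i u v → Dec (AgreeBelow i u v)
  agreeBelow? i u v = all? λ r → (toℕ r <? i) →-dec (lookup u r ≟ᶠ lookup v r)

  repeated? : ∀ u p → Dec (Repeated u p)
  repeated? u p = any? λ p′ → ¬? (p′ ≟ᶠ p) ×-dec (lookup u p′ ≟ᶠ lookup u p)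

  Surjective-update : ∀ u {p} → Surjective u → Repeated u p → ∀ c → Surjective (u [ p ]≔ c)
  Surjective-update u {p} surj (p′ , p′≢p , same) c k with c ≟ᶠ k
  ... | yes c≡k = p , trans (lookup∘update p u c) c≡k
  ... | no _ with surj k
  ...   | r , uᵣ≡k with r ≟ᶠ p
  ...     | no r≢p  = r , trans (lookup∘update′ r≢p u c) uᵣ≡k
  ...     | yes refl = p′ , trans (lookup∘update′ p′≢p u c) (trans same uᵣ≡k)

  AgreeExcept-update : ∀ u p c → AgreeExcept p (u [ p ]≔ c) u
  AgreeExcept-update u p c r r≢p = lookup∘update′ r≢p u c

  AgreeExcept⇒AgreeBelow : ∀ {i p u v} → i ≤ toℕ p → AgreeExcept p u v → AgreeBelow i u v
  AgreeExcept⇒AgreeBelow i≤p agree r r<i = agree r λ { refl → <⇒≱ r<i i≤p }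

  AgreeBelow-update : ∀ {i p} u {v} c → i ≤ toℕ p → AgreeBelow i u v → AgreeBelow i (u [ p ]≔ c) v
  AgreeBelow-update {p = p} u c i≤p agree r r<i =
    trans (AgreeExcept⇒AgreeBelow {u = u [ p ]≔ c} {u} i≤p (AgreeExcept-update u p c) r r<i) (agree r r<i)

  AgreeBelow-suc : ∀ {i p u v} → toℕ p ≡ i → AgreeBelow i u v → lookup u p ≡ lookup v p →
                   AgreeBelow (suc i) u v
  AgreeBelow-suc {i} p≡i agree uₚ≡vₚ r r<1+i with m<1+n⇒m<n∨m≡n r<1+i
  ... | inj₁ r<i = agree r r<i
  ... | inj₂ r≡i with toℕ-injective (trans r≡i (sym p≡i))
  ...   | refl = uₚ≡vₚ

module Connectivity {h n : ℕ} {{_ : NonZero h}} (h<n : h < n) where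

  canonical : Word h n
  canonical = tabulate λ r → toℕ r mod h

  toℕ-canonical : ∀ {r} → toℕ r < h → toℕ (lookup canonical r) ≡ toℕ r
  toℕ-canonical {r} r<h = begin
    toℕ (lookup canonical r) ≡⟨ cong toℕ (lookup∘tabulate (λ r → toℕ r mod h) r) ⟩
    toℕ (toℕ r mod h)        ≡⟨ toℕ-fromℕ< (m%n<n (toℕ r) h) ⟩
    toℕ r % h                ≡⟨ m<n⇒m%n≡m r<h ⟩
    toℕ r                    ∎
    where open ≡-Reasoning

  canonical-injective : ∀ {q r} → toℕ q < h → toℕ r < h → lookup canonical q ≡ lookup canonical r → q ≡ r
  canonical-injective q<h r<h eq =
    toℕ-injective (trans (sym (toℕ-canonical q<h)) (trans (cong toℕ eq) (toℕ-canonical r<h)))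

  letterPosition : Fin h → Fin n
  letterPosition a = fromℕ< (<-trans (toℕ<n a) h<n)

  toℕ-letterPosition : ∀ a → toℕ (letterPosition a) ≡ toℕ a
  toℕ-letterPosition a = toℕ-fromℕ< (<-trans (toℕ<n a) h<n)

  lookup-canonical-letterPosition : ∀ a → lookup canonical (letterPosition a) ≡ a
  lookup-canonical-letterPosition a = toℕ-injective (trans
    (toℕ-canonical (subst (_< h) (sym (toℕ-letterPosition a)) (toℕ<n a)))
    (toℕ-letterPosition a))

  canonical-surjective : Surjective canonical
  canonical-surjective a = letterPosition a , lookup-canonical-letterPosition a

  -- Once the prefix of length i ≥ h agrees with the canonical word, it contains every letter.
  prefix-repeats : ∀ {i} (i<n : i < n) {u} → h ≤ i → AgreeBelow i u canonical → Repeated u (fromℕ< i<n)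
  prefix-repeats {i} i<n {u} h≤i agree = r , r≢pos , trans (agree r r<i) (lookup-canonical-letterPosition a)
    where
    a = lookup u (fromℕ< i<n)
    r = letterPosition a
    r<i : toℕ r < i
    r<i = subst (_< i) (sym (toℕ-letterPosition a)) (<-≤-trans (toℕ<n a) h≤i)
    r≢pos : r ≢ fromℕ< i<n
    r≢pos r≡pos = <-irrefl (trans (cong toℕ r≡pos) (toℕ-fromℕ< i<n)) r<i

  module _ {P : Word h n → Set} (closed : EditClosed P) where

    -- If the letter at i is not repeated then i < h, and the pigeonhole pair q < q′ has i ≤ q′ because
    -- the first i letters are distinct; overwriting q′ with that letter keeps the word surjective.
    makeRepeated : ∀ {i} (i<n : i < n) {u} → Surjective u → AgreeBelow i u canonical →
                   ∃[ u′ ] Surjective u′ × AgreeBelow i u′ canonical × Repeated u′ (fromℕ< i<n) ×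
                           (P u′ → P u)
    makeRepeated {i} i<n {u} surj agree with repeated? u (fromℕ< i<n)
    ... | yes rep = u , surj , agree , rep , λ Pu → Pu
    ... | no ¬rep =
      u′ , surj′ , AgreeBelow-update u {canonical} uᵢ i≤q′ agree , (q′ , q′≢pos , u′-repeats) ,
      closed {u′} {u} q′ surj′ surj (AgreeExcept-update u q′ uᵢ)
      where
      pos = fromℕ< i<n
      uᵢ = lookup u pos
      i<h = ≰⇒> λ h≤i → ¬rep (prefix-repeats i<n {u} h≤i agree)
      pair = pigeonhole h<n (lookup u)
      q = proj₁ pair
      q′ = proj₁ (proj₂ pair)
      q<q′ = proj₁ (proj₂ (proj₂ pair))
      uq≡uq′ = proj₂ (proj₂ (proj₂ pair))
      q≢q′ : q ≢ q′
      q≢q′ q≡q′ = <-irrefl (cong toℕ q≡q′) q<q′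
      q′≢pos : q′ ≢ pos
      q′≢pos q′≡pos =
        ¬rep (q , (λ q≡pos → q≢q′ (trans q≡pos (sym q′≡pos))) , trans uq≡uq′ (cong (lookup u) q′≡pos))
      i≤q′ : i ≤ toℕ q′
      i≤q′ = ≮⇒≥ λ q′<i → q≢q′ (canonical-injective
        (<-trans (<-trans q<q′ q′<i) i<h) (<-trans q′<i i<h)
        (trans (sym (agree q (<-trans q<q′ q′<i))) (trans uq≡uq′ (agree q′ q′<i))))
      u′ = u [ q′ ]≔ uᵢ
      surj′ = Surjective-update u surj (q , q≢q′ , uq≡uq′) uᵢ
      u′-repeats : lookup u′ q′ ≡ lookup u′ pos
      u′-repeats =
        trans (lookup∘update q′ u uᵢ) (sym (lookup∘update′ (λ pos≡q′ → q′≢pos (sym pos≡q′)) u uᵢ))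

    fixPosition : ∀ {i} (i<n : i < n) {u} → Surjective u → AgreeBelow i u canonical →
                  ∃[ v ] Surjective v × AgreeBelow (suc i) v canonical × (P v → P u)
    fixPosition i<n surj agree with makeRepeated i<n surj agree
    ... | u′ , surj′ , agree′ , rep , back =
      v , surjᵥ , AgreeBelow-suc {u = v} {canonical} (toℕ-fromℕ< i<n) agreeᵥ (lookup∘update pos u′ c) ,
      λ Pv → back (closed {v} {u′} pos surjᵥ surj′ (AgreeExcept-update u′ pos c) Pv)
      where
      pos = fromℕ< i<n
      c = lookup canonical pos
      v = u′ [ pos ]≔ c
      surjᵥ = Surjective-update u′ surj′ rep c
      agreeᵥ = AgreeBelow-update u′ {canonical} c (≤-reflexive (sym (toℕ-fromℕ< i<n))) agree′

    extendPrefix : ∀ k {i} → i + k ≡ n → ∀ {u} → Surjective u → AgreeBelow i u canonical →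
                   P canonical → P u
    extendPrefix zero {i} i+0≡n {u} surj agree Pz = subst P (sym u≡canonical) Pz
      where
      u≡canonical : u ≡ canonical
      u≡canonical = Pointwise-≡⇒≡ (ext λ r →
        agree r (subst (toℕ r <_) (trans (sym i+0≡n) (+-identityʳ i)) (toℕ<n r)))
    extendPrefix (suc k) {i} i+k≡n surj agree Pz
      with fixPosition (subst (i <_) i+k≡n (m<m+n i z<s)) surj agree
    ... | v , surjᵥ , agreeᵥ , back = back (extendPrefix k (trans (sym (+-suc i k)) i+k≡n) surjᵥ agreeᵥ Pz)

    editClosed⇒surjective : P canonical → ∀ u → Surjective u → P u
    editClosed⇒surjective Pz u surj = extendPrefix n refl surj (λ _ ()) Pz

module Rotation {h n s : ℕ} (s<n : s < n) where

  m : ℕ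
  m = n ∸ s

  s+m≡n : s + m ≡ n
  s+m≡n = m+[n∸m]≡n (<⇒≤ s<n)

  0<n : 0 < n
  0<n = ≤-<-trans z≤n s<n

  instance
    n-nonZero : NonZero n
    n-nonZero = >-nonZero 0<n

  shift : ℕ → Fin n → Fin n
  shift d q = (toℕ q + d) mod n

  toℕ-shift : ∀ d q → toℕ (shift d q) ≡ (toℕ q + d) % n
  toℕ-shift d q = toℕ-fromℕ< (m%n<n (toℕ q + d) n)

  toℕ-shift-< : ∀ {d q} → toℕ q + d < n → toℕ (shift d q) ≡ toℕ q + d
  toℕ-shift-< {d} {q} q+d<n = trans (toℕ-shift d q) (m<n⇒m%n≡m q+d<n)

  shift-shift : ∀ d e q → shift d (shift e q) ≡ shift (e + d) q
  shift-shift d e q = toℕ-injective (begin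
    toℕ (shift d (shift e q))      ≡⟨ toℕ-shift d (shift e q) ⟩
    (toℕ (shift e q) + d) % n      ≡⟨ cong (λ x → (x + d) % n) (toℕ-shift e q) ⟩
    ((toℕ q + e) % n + d) % n      ≡⟨ %-distribˡ-+ ((toℕ q + e) % n) d n ⟩
    ((toℕ q + e) % n % n + d % n) % n ≡⟨ cong (λ x → (x + d % n) % n) (m%n%n≡m%n (toℕ q + e) n) ⟩
    ((toℕ q + e) % n + d % n) % n  ≡⟨ sym (%-distribˡ-+ (toℕ q + e) d n) ⟩
    (toℕ q + e + d) % n            ≡⟨ cong (_% n) (+-assoc (toℕ q) e d) ⟩
    (toℕ q + (e + d)) % n          ≡⟨ sym (toℕ-shift (e + d) q) ⟩
    toℕ (shift (e + d) q)          ∎)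
    where open ≡-Reasoning

  shift-multiple : ∀ k q → shift (k * n) q ≡ q
  shift-multiple k q = toℕ-injective (trans (toℕ-shift (k * n) q)
    (trans ([m+kn]%n≡m%n (toℕ q) k n) (m<n⇒m%n≡m (toℕ<n q))))

  shift-inverse : ∀ {d e} → e + d ≡ n → ∀ q → shift d (shift e q) ≡ q
  shift-inverse {d} {e} e+d≡n q = begin
    shift d (shift e q) ≡⟨ shift-shift d e q ⟩
    shift (e + d) q     ≡⟨ cong (λ x → shift x q) (trans e+d≡n (sym (*-identityˡ n))) ⟩
    shift (1 * n) q     ≡⟨ shift-multiple 1 q ⟩
    q                   ∎
    where open ≡-Reasoning

  rotate : Word h n → Word h n
  rotate w = tabulate λ q → lookup w (shift m q)

  rotate^ : ℕ → Word h n → Word h n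
  rotate^ t w = fold w rotate t

  lookup-rotate : ∀ w q → lookup (rotate w) q ≡ lookup w (shift m q)
  lookup-rotate w q = lookup∘tabulate (λ q → lookup w (shift m q)) q

  lookup-rotate^ : ∀ t w q → lookup (rotate^ t w) q ≡ lookup w (shift (t * m) q)
  lookup-rotate^ zero    w q = cong (lookup w) (sym (shift-multiple 0 q))
  lookup-rotate^ (suc t) w q = begin
    lookup (rotate (rotate^ t w)) q     ≡⟨ lookup-rotate (rotate^ t w) q ⟩
    lookup (rotate^ t w) (shift m q)    ≡⟨ lookup-rotate^ t w (shift m q) ⟩
    lookup w (shift (t * m) (shift m q)) ≡⟨ cong (lookup w) (shift-shift (t * m) m q) ⟩
    lookup w (shift (m + t * m) q)      ∎
    where open ≡-Reasoning

  rotate^-n : ∀ w → rotate^ n w ≡ w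
  rotate^-n w = Pointwise-≡⇒≡ (ext λ q → trans (lookup-rotate^ n w q)
    (cong (lookup w) (trans (cong (λ d → shift d q) (*-comm n m)) (shift-multiple m q))))

  rotate^-+ : ∀ a b w → rotate^ (a + b) w ≡ rotate^ a (rotate^ b w)
  rotate^-+ a b w = fold-+ w rotate a

  rotate^-pred-rotate : ∀ w → rotate^ (pred n) (rotate w) ≡ w
  rotate^-pred-rotate w = begin
    rotate^ (pred n) (rotate^ 1 w) ≡⟨ sym (rotate^-+ (pred n) 1 w) ⟩
    rotate^ (pred n + 1) w         ≡⟨ cong (λ t → rotate^ t w) (trans (+-comm (pred n) 1) (suc-pred n)) ⟩
    rotate^ n w                    ≡⟨ rotate^-n w ⟩
    w                              ∎
    where open ≡-Reasoning

  rotate-injective : ∀ {x y} → rotate x ≡ rotate y → x ≡ y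
  rotate-injective {x} {y} eq =
    trans (sym (rotate^-pred-rotate x)) (trans (cong (rotate^ (pred n)) eq) (rotate^-pred-rotate y))

  rotate^-injective : ∀ t {x y} → rotate^ t x ≡ rotate^ t y → x ≡ y
  rotate^-injective zero    eq = eq
  rotate^-injective (suc t) eq = rotate^-injective t (rotate-injective eq)

  rotate-surjective : ∀ {w} → Surjective w → Surjective (rotate w)
  rotate-surjective {w} surj k = let i , wᵢ≡k = surj k in
    shift s i , trans (lookup-rotate w (shift s i)) (trans (cong (lookup w) (shift-inverse s+m≡n i)) wᵢ≡k)

  rotate^-surjective : ∀ t {w} → Surjective w → Surjective (rotate^ t w)
  rotate^-surjective zero    surj = surj
  rotate^-surjective (suc t) {w} surj = rotate-surjective {rotate^ t w} (rotate^-surjective t surj)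

  Overlap-rotate : ∀ w → Overlap s w (rotate w)
  Overlap-rotate w j k j<s k≡m+j = sym (trans (lookup-rotate w j) (cong (lookup w) (toℕ-injective
    (trans (toℕ-shift-< {m} {j} j+m<n) (trans (+-comm (toℕ j) m) (sym k≡m+j))))))
    where
    j+m<n : toℕ j + m < n
    j+m<n = subst (toℕ j + m <_) s+m≡n (+-monoˡ-< m j<s)

  Overlap-respʳ-AgreeBelow : ∀ {x y : Word h n} → AgreeBelow s x y → ∀ p → Overlap s p x → Overlap s p y
  Overlap-respʳ-AgreeBelow agree p pRx j k j<s k≡ = trans (pRx j k j<s k≡) (agree j j<s)

  module _ {P : Word h n → Set} (rotate⁺ : ∀ {x} → P x → P (rotate x)) where

    rotate^⁺ : ∀ t {x} → P x → P (rotate^ t x)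
    rotate^⁺ zero    Px = Px
    rotate^⁺ (suc t) Px = rotate⁺ (rotate^⁺ t Px)

    rotate⁻ : ∀ {x} → P (rotate x) → P x
    rotate⁻ {x} Prx = subst P (rotate^-pred-rotate x) (rotate^⁺ (pred n) Prx)

    rotate^⁻ : ∀ t {x} → P (rotate^ t x) → P x
    rotate^⁻ zero    Px = Px
    rotate^⁻ (suc t) Px = rotate^⁻ t (rotate⁻ Px)

  AgreeExcept-rotate : ∀ {p u v} → AgreeExcept p u v → AgreeExcept (shift s p) (rotate u) (rotate v)
  AgreeExcept-rotate {p} {u} {v} agree r r≢q = begin
    lookup (rotate u) r ≡⟨ lookup-rotate u r ⟩
    lookup u (shift m r) ≡⟨ agree (shift m r) shifted≢p ⟩
    lookup v (shift m r) ≡⟨ sym (lookup-rotate v r) ⟩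
    lookup (rotate v) r ∎
    where
    open ≡-Reasoning
    shifted≢p : shift m r ≢ p
    shifted≢p eq = r≢q (trans (sym (shift-inverse (trans (+-comm m s) s+m≡n) r)) (cong (shift s) eq))

  shift-back : ∀ p → toℕ (shift s p) < s → toℕ (shift s p) + m ≡ toℕ p
  shift-back p q<s = trans (sym (toℕ-shift-< {m} {shift s p} q+m<n)) (cong toℕ (shift-inverse {m} {s} s+m≡n p))
    where
    q+m<n : toℕ (shift s p) + m < n
    q+m<n = subst (toℕ (shift s p) + m <_) s+m≡n (+-monoˡ-< m q<s)

  record RotationClosed (P : Word h n → Set) : Set where
    field
      rotate⁺     : ∀ {x} → P x → P (rotate x)
      agreeBelow⁺ : ∀ {x y} → P x → Surjective y → AgreeBelow s x y → P y

  module _ {P : Word h n → Set} (closed : RotationClosed P) where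

    open RotationClosed closed

    -- An edit at a position p < s is carried by one rotation to position p − m; the fuel bounds
    -- that position while it stays inside the overlap window.
    private
      edit : ∀ fuel {u v} p → (toℕ p < s → toℕ p < fuel) → Surjective u → Surjective v →
             AgreeExcept p u v → P u → P v
      edit fuel {u} {v} p bound surjᵤ surjᵥ agree Pu with s ≤? toℕ p | fuel
      ... | yes s≤p | _ = agreeBelow⁺ Pu surjᵥ (AgreeExcept⇒AgreeBelow {u = u} {v} s≤p agree)
      ... | no s≰p | zero = contradiction (bound (≰⇒> s≰p)) λ ()
      ... | no s≰p | suc fuel′ =
        rotate⁻ {P} rotate⁺ {v} (edit fuel′ (shift s p) bound′
          (rotate-surjective {u} surjᵤ) (rotate-surjective {v} surjᵥ)
          (AgreeExcept-rotate {p} {u} {v} agree) (rotate⁺ {u} Pu))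
        where
        bound′ : toℕ (shift s p) < s → toℕ (shift s p) < fuel′
        bound′ q<s = <-≤-trans (m<m+n (toℕ (shift s p)) (m<n⇒0<n∸m s<n))
                               (s≤s⁻¹ (subst (_< suc fuel′) (sym (shift-back p q<s)) (bound (≰⇒> s≰p))))

    rotationClosed⇒editClosed : EditClosed P
    rotationClosed⇒editClosed p = edit s p (λ p<s → p<s)


module Construction {h n s : ℕ} {{_ : NonZero h}} (s<n : s < n) (h<n : h < n) where

  open Rotation {h} s<n
  open Connectivity h<n
  open Permutation (setoid (Word h n)) using (_↭_; ↭-sym)
  open PermutationProperties (setoid (Word h n)) using (∈-resp-↭; Unique-resp-↭)

  _≟ʷ_ : DecidableEquality (Word h n)
  _≟ʷ_ = ≡-dec _≟ᶠ_

  record Orbit (e : Word h n) : Set where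
    field
      rest          : List (Word h n)
      walk          : Walk (Overlap s) e rest e
      unique        : Unique (e ∷ rest)
      ∈⇒rotate^     : ∀ {x} → x ∈ e ∷ rest → ∃[ j ] x ≡ rotate^ j e
      rotate-closed : ∀ {x} → x ∈ e ∷ rest → rotate x ∈ e ∷ rest

  -- The orbit of e is listed up to its least positive period.
  orbit : ∀ e → Orbit e
  orbit e with leastWitness (λ k → (0 <? k) ×-dec (rotate^ k e ≟ʷ e)) (0<n , rotate^-n e)
  ... | suc j , (_ , period) , minimal = record
    { rest          = applyUpTo (λ i → iterate (suc i)) j
    ; walk          = subst (Walk (Overlap s) e (applyUpTo (λ i → iterate (suc i)) j)) period
                            (Walk-applyUpTo {R = Overlap s} iterate (λ i → Overlap-rotate (iterate i)) j)
    ; unique        = applyUpTo⁺₁ iterate (suc j) distinct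
    ; ∈⇒rotate^     = λ x∈ → let i , _ , x≡ = ∈-applyUpTo⁻ iterate x∈ in i , x≡
    ; rotate-closed = closed
    }
    where
    iterate : ℕ → Word h n
    iterate i = rotate^ i e

    distinct : ∀ {a b} → a < b → b < suc j → iterate a ≢ iterate b
    distinct {a} {b} a<b b<k eq = minimal (b ∸ a) (≤-<-trans (m∸n≤m b a) b<k) (m<n⇒0<n∸m a<b , sym e≡)
      where
      e≡ : e ≡ rotate^ (b ∸ a) e
      e≡ = rotate^-injective a (trans eq (trans (cong (λ t → rotate^ t e) (sym (m+[n∸m]≡n (<⇒≤ a<b))))
                                                (rotate^-+ a (b ∸ a) e)))
    closed : ∀ {x} → x ∈ applyUpTo iterate (suc j) → rotate x ∈ applyUpTo iterate (suc j)
    closed x∈ with ∈-applyUpTo⁻ iterate x∈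
    ... | i , i<k , refl with m<1+n⇒m<n∨m≡n i<k
    ...   | inj₁ i<j  = ∈-applyUpTo⁺ iterate (s≤s i<j)
    ...   | inj₂ refl = here period

  orbit-surjective : ∀ {e} → Surjective e → ∀ {x} → x ∈ e ∷ Orbit.rest (orbit e) → Surjective x
  orbit-surjective {e} surj x∈ with Orbit.∈⇒rotate^ (orbit e) x∈
  ... | j , refl = rotate^-surjective j surj

  record PartialCycle : Set where
    field
      first         : Word h n
      rest          : List (Word h n)
      walk          : Walk (Overlap s) first rest first
      unique        : Unique (first ∷ rest)
      surjective    : ∀ {x} → x ∈ first ∷ rest → Surjective x
      rotate-closed : ∀ {x} → x ∈ first ∷ rest → rotate x ∈ first ∷ rest
      canonical∈    : canonical ∈ first ∷ rest

    elements : List (Word h n)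
    elements = first ∷ rest

  open PartialCycle

  -- The last element of y's orbit overlaps y, hence also x; the element of C before x overlaps x,
  -- hence also y.
  module Merge (C : PartialCycle) {x y} (surjʸ : Surjective y) (y∉C : y ∉ elements C)
               (x∈C : x ∈ elements C) (agree : AgreeBelow s x y) where

    private
      module O = Orbit (orbit y)
      rotated = Walk-rotate (rest C) (walk C) x∈C
      D = proj₁ rotated
      x⇝x = proj₁ (proj₂ rotated)
      C↭xD = proj₂ (proj₂ rotated)

    merged : List (Word h n)
    merged = (y ∷ O.rest) ++ (x ∷ D)

    merged-↭ : merged ↭ (y ∷ O.rest) ++ elements C
    merged-↭ = PermutationProperties.++⁺ˡ (setoid (Word h n)) (y ∷ O.rest) (↭-sym C↭xD)

    elements⊆merged : elements C ⊆ merged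
    elements⊆merged w∈C = ∈-resp-↭ (↭-sym merged-↭) (∈-++⁺ʳ (y ∷ O.rest) w∈C)

    orbit⊆merged : y ∷ O.rest ⊆ merged
    orbit⊆merged = ∈-++⁺ˡ

    ∈-merged⁻ : ∀ {w} → w ∈ merged → w ∈ y ∷ O.rest ⊎ w ∈ elements C
    ∈-merged⁻ w∈ = ∈-++⁻ (y ∷ O.rest) (∈-resp-↭ merged-↭ w∈)

    -- C is closed under rotation and misses y, so it misses y's whole orbit.
    orbit-disjoint : Disjoint (y ∷ O.rest) (elements C)
    orbit-disjoint (w∈O , w∈C) with O.∈⇒rotate^ w∈O
    ... | j , refl = y∉C (rotate^⁻ {P = _∈ elements C} (rotate-closed C) j w∈C)

    mergedCycle : PartialCycle
    mergedCycle = record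
      { first         = y
      ; rest          = O.rest ++ x ∷ D
      ; walk          = Walk-++ O.rest y⇝x x⇝y
      ; unique        = Unique-resp-↭ (↭-sym merged-↭) (++⁺ O.unique (unique C) orbit-disjoint)
      ; surjective    = λ w∈ → [ orbit-surjective surjʸ , surjective C ] (∈-merged⁻ w∈)
      ; rotate-closed = λ w∈ →
          [ orbit⊆merged ∘ O.rotate-closed , elements⊆merged ∘ rotate-closed C ] (∈-merged⁻ w∈)
      ; canonical∈    = elements⊆merged (canonical∈ C)
      }
      where
      y⇝x : Walk (Overlap s) y O.rest x
      y⇝x = Walk-mapLast O.rest (Overlap-respʳ-AgreeBelow {x = y} {x} (AgreeBelow-sym {u = x} {y} agree)) O.walk
      x⇝y : Walk (Overlap s) x D y
      x⇝y = Walk-mapLast D (Overlap-respʳ-AgreeBelow {x = x} {y} agree) x⇝x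

  initialCycle : PartialCycle
  initialCycle = record
    { first         = canonical
    ; rest          = O.rest
    ; walk          = O.walk
    ; unique        = O.unique
    ; surjective    = orbit-surjective canonical-surjective
    ; rotate-closed = O.rotate-closed
    ; canonical∈    = here refl
    }
    where module O = Orbit (orbit canonical)

  open Missing _≟ʷ_
  open import Data.List.Membership.DecPropositional _≟ʷ_ using (_∈?_)

  words : List (Word h n)
  words = vecs (allFin h) n

  ∈-words : ∀ w → w ∈ words
  ∈-words = ∈-vecs ∈-allFin

  Attachable : PartialCycle → Word h n → Set
  Attachable C y = Surjective y × y ∉ elements C × Any (λ x → AgreeBelow s x y) (elements C)

  attachable? : ∀ C y → Dec (Attachable C y)
  attachable? C y =
    surjective? y ×-dec ¬? (y ∈? elements C) ×-dec Any.any? (λ x → agreeBelow? s x y) (elements C)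

  saturate : ∀ fuel C → missing (elements C) words < fuel →
             ∃[ C′ ] (∀ w → Surjective w → w ∈ elements C′)
  saturate (suc fuel) C bound with Any.any? (attachable? C) words
  ... | no ¬ext =
    C , editClosed⇒surjective (rotationClosed⇒editClosed {P = _∈ elements C} closure) (canonical∈ C)
    where
    agreeBelow⁺ : ∀ {x y} → x ∈ elements C → Surjective y → AgreeBelow s x y → y ∈ elements C
    agreeBelow⁺ {x} {y} x∈C surjʸ agree with y ∈? elements C
    ... | yes y∈C = y∈C
    ... | no  y∉C = contradiction (lose (∈-words y) (surjʸ , y∉C , lose x∈C agree)) ¬ext
    closure : RotationClosed (_∈ elements C)
    closure = record { rotate⁺ = rotate-closed C ; agreeBelow⁺ = agreeBelow⁺ }
  ... | yes extension =
    let y , surjʸ , y∉C , agreeing = Any.satisfied extension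
        x , x∈C , agree = find agreeing
        open Merge C surjʸ y∉C x∈C agree
    in saturate fuel mergedCycle
         (<-≤-trans (missing-strict elements⊆merged y∉C (orbit⊆merged (here refl)) (∈-words y))
                    (s≤s⁻¹ bound))

  overlapCycle : ∃[ L ] IsOverlapCycle s (Surjective {h} {n}) L
  overlapCycle =
    let C , covers = saturate _ initialCycle ≤-refl
    in elements C , unique C , (λ w → mk⇔ (surjective C) (covers w)) , Walk⇒CyclicOverlap (rest C) (walk C)

mainTheorem4 : (n s h : ℕ) → 1 ≤ h → 1 ≤ s → s ≤ n ∸ 2 → h ≤ n ∸ 1 →
    Σ (List (Word h n)) λ L → IsOverlapCycle s (Surjective {h} {n}) L
mainTheorem4 zero          s h _   1≤s s≤n∸2 _       = contradiction s≤n∸2 (<⇒≱ 1≤s)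
mainTheorem4 (suc zero)    s h _   1≤s s≤n∸2 _       = contradiction s≤n∸2 (<⇒≱ 1≤s)
mainTheorem4 (suc (suc k)) s h 1≤h _   s≤k   h≤1+k =
  Construction.overlapCycle {{>-nonZero 1≤h}} (s≤s (m≤n⇒m≤1+n s≤k)) (s≤s h≤1+k)
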